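{- For all integers $s$ and $j$: for every non-negative integer $n$, \[ 2\sum_{k = 0}^n \binom{2n}{2k}F_{j(4k + s)} = \left( L_j^{2n} + 5^n F_j^{2n} \right)F_{j(2n + s)},\qquad 2\sum_{k = 0}^n \binom{2n}{2k}L_{j(4k + s)} = \left( L_j^{2n} + 5^n F_j^{2n} \right)L_{j(2n + s)}, \] and for every positive integer $n$, \[ 2\sum_{k = 0}^{n - 1} \binom{2n-1}{2k}F_{j(4k + s)}= ( - 1)^j\big(L_j^{2n - 1} F_{j(2n + s - 1)} - 5^{n - 1} F_j^{2n - 1} L_{j(2n + s - 1)}\big), \] \[ 2\sum_{k = 0}^{n - 1} \binom{2n-1}{2k} L_{j(4k + s)} =( - 1)^j\big( L_j^{2n - 1} L_{j(2n + s - 1)} - 5^n F_j^{2n - 1} F_{j(2n + s - 1)}\big ). \]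
   Context: The Fibonacci numbers $F_j$ and Lucas numbers $L_j$ are defined for all integers $j$ by $F_0=0$, $F_1=1$, $L_0=2$, $L_1=1$, $F_j=F_{j-1}+F_{j-2}$, $L_j=L_{j-1}+L_{j-2}$, with $F_{ -j}=(-1)^{j-1}F_j$ and $L_{ -j}=(-1)^jL_j$. Here $0^0=1$. -}

module Defs where

open import Data.Nat as ℕ using (ℕ; zero; suc)
open import Data.Integer as ℤ using (ℤ; +_; -[1+_]; _+_; _*_; -_; _^_; ∣_∣)

fibℕ : ℕ → ℤ
fibℕ 0 = + 0
fibℕ 1 = + 1
fibℕ (suc (suc n)) = fibℕ (suc n) + fibℕ n

lucℕ : ℕ → ℤ
lucℕ 0 = + 2
lucℕ 1 = + 1
lucℕ (suc (suc n)) = lucℕ (suc n) + lucℕ n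

-- extension to all integers: F_{-m} = (-1)^(m-1) F_m, L_{-m} = (-1)^m L_m
F : ℤ → ℤ
F (+ m) = fibℕ m
F -[1+ m ] = ((- + 1) ^ m) * fibℕ (suc m)

L : ℤ → ℤ
L (+ m) = lucℕ m
L -[1+ m ] = ((- + 1) ^ suc m) * lucℕ (suc m)

negOnePow : ℤ → ℤ
negOnePow j = (- + 1) ^ ∣ j ∣

sumTo : ℕ → (ℕ → ℤ) → ℤ
sumTo zero f = + 0
sumTo (suc n) f = sumTo n f + f n

-- Write e = (-1)^j and let X satisfy the Fibonacci recurrence on ℤ.  With the companion
-- X̃ m = X (m - 1) + X (m + 1) (so F̃ = L, L̃ = 5F and, in general, X̃̃ = 5X) one has the
-- addition law 2 X (m + n) = L n X m + F n X̃ m.  Expanding X b and X (b + 2j) around b + j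
-- with n = ∓j, and using L (-j) = e L j, F (-j) = -e F j, gives
--   X b + e X (b + 2j) = e L j X (b + j),     X b - e X (b + 2j) = -e F j X̃ (b + j).
-- So for the operators Δ± = 1 ± e E², E the shift by j, the power Δ+^N multiplies by
-- (e L j)^N and shifts, while Δ-^N alternates between X and X̃, gaining 5 F j² every two
-- steps.  Adding the binomial expansions of Δ+^N X (j s) and Δ-^N X (j s) cancels the
-- odd-index terms and leaves 2 Σ_k C(N, 2k) X (j (4k + s)); take N = 2n and N = 2n - 1.

module Submission where

open import Defs
open import Data.Nat as ℕ using (ℕ; suc; zero)
open import Data.Nat.Combinatorics using (_C_; k>n⇒nCk≡0; nCk+nC[k+1]≡[n+1]C[k+1])
open import Data.Integer using (ℤ; +_; -[1+_]; _+_; _-_; _*_; _^_; -_; ∣_∣)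
open import Data.Integer.Tactic.RingSolver using (solve-∀)
import Data.Integer.Properties as ℤₚ
import Data.Nat.Properties as ℕₚ
open import Data.Product using (_×_; _,_; proj₁)
open import Relation.Binary.PropositionalEquality
open ≡-Reasoning

sumTo-cong : ∀ n {g h : ℕ → ℤ} → (∀ i → g i ≡ h i) → sumTo n g ≡ sumTo n h
sumTo-cong zero eq = refl
sumTo-cong (suc n) eq = cong₂ _+_ (sumTo-cong n eq) (eq n)

sumTo-+ : ∀ n (g h : ℕ → ℤ) → sumTo n (λ i → g i + h i) ≡ sumTo n g + sumTo n h
sumTo-+ zero g h = refl
sumTo-+ (suc n) g h rewrite sumTo-+ n g h = interchange (sumTo n g) (sumTo n h) (g n) (h n)
  where
  interchange : ∀ a b c d → a + b + (c + d) ≡ a + c + (b + d)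
  interchange = solve-∀

sumTo-*ˡ : ∀ n k (g : ℕ → ℤ) → sumTo n (λ i → k * g i) ≡ k * sumTo n g
sumTo-*ˡ zero k g = sym (ℤₚ.*-zeroʳ k)
sumTo-*ˡ (suc n) k g rewrite sumTo-*ˡ n k g = sym (ℤₚ.*-distribˡ-+ k (sumTo n g) (g n))

sumTo-pad : ∀ n d (g : ℕ → ℤ) → (∀ i → n ℕ.≤ i → g i ≡ + 0) → sumTo (d ℕ.+ n) g ≡ sumTo n g
sumTo-pad n zero g vanish = refl
sumTo-pad n (suc d) g vanish =
  trans (cong₂ _+_ (sumTo-pad n d g vanish) (vanish (d ℕ.+ n) (ℕₚ.m≤n+m n d))) (ℤₚ.+-identityʳ _)

sumTo-pairs : ∀ n (g : ℕ → ℤ) → sumTo (2 ℕ.* n) g ≡ sumTo n (λ k → g (2 ℕ.* k) + g (suc (2 ℕ.* k)))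
sumTo-pairs zero g = refl
sumTo-pairs (suc n) g = begin
  sumTo (2 ℕ.* suc n) g                                 ≡⟨ cong (λ m → sumTo m g) (ℕₚ.*-suc 2 n) ⟩
  sumTo (2 ℕ.* n) g + g (2 ℕ.* n) + g (suc (2 ℕ.* n))   ≡⟨ ℤₚ.+-assoc (sumTo (2 ℕ.* n) g) _ _ ⟩
  sumTo (2 ℕ.* n) g + (g (2 ℕ.* n) + g (suc (2 ℕ.* n))) ≡⟨ cong (_+ (g (2 ℕ.* n) + g (suc (2 ℕ.* n)))) (sumTo-pairs n g) ⟩
  sumTo (suc n) (λ k → g (2 ℕ.* k) + g (suc (2 ℕ.* k))) ∎

binomial-vanishes : ∀ {N i} a → N ℕ.< i → + (N C i) * a ≡ + 0
binomial-vanishes a N<i rewrite k>n⇒nCk≡0 N<i = ℤₚ.*-zeroˡ a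

sumTo-pascal : ∀ N M (a : ℕ → ℤ) →
  sumTo (suc M) (λ i → + (suc N C i) * a i)
    ≡ sumTo (suc M) (λ i → + (N C i) * a i) + sumTo M (λ i → + (N C i) * a (suc i))
sumTo-pascal N zero a = sym (ℤₚ.+-identityʳ _)
sumTo-pascal N (suc M) a = begin
  sumTo (suc M) (λ i → + (suc N C i) * a i) + + (suc N C suc M) * a (suc M)
    ≡⟨ cong₂ _+_ (sumTo-pascal N M a) (cong (λ x → + x * a (suc M)) (sym (nCk+nC[k+1]≡[n+1]C[k+1] N M))) ⟩
  A + B + + (N C M ℕ.+ N C suc M) * a (suc M)
    ≡⟨ cong (λ x → A + B + x * a (suc M)) (ℤₚ.pos-+ (N C M) (N C suc M)) ⟩
  A + B + (+ (N C M) + + (N C suc M)) * a (suc M)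
    ≡⟨ interchange A B (+ (N C M)) (+ (N C suc M)) (a (suc M)) ⟩
  (A + + (N C suc M) * a (suc M)) + (B + + (N C M) * a (suc M)) ∎
  where
  A B : ℤ
  A = sumTo (suc M) (λ i → + (N C i) * a i)
  B = sumTo M (λ i → + (N C i) * a (suc i))
  interchange : ∀ A B x y z → A + B + (x + y) * z ≡ (A + y * z) + (B + x * z)
  interchange = solve-∀

^-even-of-involution : ∀ c → c * c ≡ + 1 → ∀ k → c ^ (2 ℕ.* k) ≡ + 1
^-even-of-involution c cc k = begin
  c ^ (2 ℕ.* k)  ≡⟨ ℤₚ.^-*-assoc c 2 k ⟨
  (c * (c * + 1)) ^ k ≡⟨ cong (λ x → (c * x) ^ k) (ℤₚ.*-identityʳ c) ⟩
  (c * c) ^ k    ≡⟨ cong (_^ k) cc ⟩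
  (+ 1) ^ k      ≡⟨ ℤₚ.^-zeroˡ k ⟩
  + 1            ∎

sumTo-even-part : ∀ c → c * c ≡ + 1 → ∀ n (g : ℕ → ℤ) →
  sumTo (2 ℕ.* n) (λ i → c ^ i * g i + (- c) ^ i * g i) ≡ + 2 * sumTo n (λ k → g (2 ℕ.* k))
sumTo-even-part c cc n g = begin
  sumTo (2 ℕ.* n) (λ i → c ^ i * g i + (- c) ^ i * g i)   ≡⟨ sumTo-pairs n _ ⟩
  sumTo n (λ k → h (2 ℕ.* k) + h (suc (2 ℕ.* k)))          ≡⟨ sumTo-cong n pair ⟩
  sumTo n (λ k → + 2 * g (2 ℕ.* k))                         ≡⟨ sumTo-*ˡ n (+ 2) _ ⟩
  + 2 * sumTo n (λ k → g (2 ℕ.* k))                         ∎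
  where
  h : ℕ → ℤ
  h i = c ^ i * g i + (- c) ^ i * g i
  -c*-c : - c * - c ≡ + 1
  -c*-c = trans (neg-square c) cc
    where
    neg-square : ∀ x → - x * - x ≡ x * x
    neg-square = solve-∀
  cancel-odd : ∀ p q x y → p ≡ + 1 → q ≡ + 1 → p * x + q * x + (c * p * y + - c * q * y) ≡ + 2 * x
  cancel-odd .(+ 1) .(+ 1) x y refl refl = cancel c x y
    where
    cancel : ∀ c x y → + 1 * x + + 1 * x + (c * + 1 * y + - c * + 1 * y) ≡ + 2 * x
    cancel = solve-∀
  pair : ∀ k → h (2 ℕ.* k) + h (suc (2 ℕ.* k)) ≡ + 2 * g (2 ℕ.* k)
  pair k = cancel-odd _ _ (g (2 ℕ.* k)) (g (suc (2 ℕ.* k)))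
    (^-even-of-involution c cc k) (^-even-of-involution (- c) -c*-c k)

odd-predecessor : ∀ m → 2 ℕ.* suc m ℕ.∸ 1 ≡ suc (2 ℕ.* m)
odd-predecessor m = cong (ℕ._∸ 1) (ℕₚ.*-suc 2 m)

^-distrib-* : ∀ x y n → (x * y) ^ n ≡ x ^ n * y ^ n
^-distrib-* x y zero = refl
^-distrib-* x y (suc n) = trans (cong ((x * y) *_) (^-distrib-* x y n)) (interchange x y (x ^ n) (y ^ n))
  where
  interchange : ∀ a b c d → a * b * (c * d) ≡ a * c * (b * d)
  interchange = solve-∀

^-square : ∀ x n → (x * x) ^ n ≡ x ^ (2 ℕ.* n)
^-square x n = trans (cong (λ y → (x * y) ^ n) (sym (ℤₚ.*-identityʳ x))) (ℤₚ.^-*-assoc x 2 n)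

module Shift (c t : ℤ) where

  Δ : (ℤ → ℤ) → ℤ → ℤ
  Δ f b = f b + c * f (b + t)

  Δ^ : ℕ → (ℤ → ℤ) → ℤ → ℤ
  Δ^ zero f = f
  Δ^ (suc N) f = Δ (Δ^ N f)

  Δ^-binomial : ∀ N f m → Δ^ N f m ≡ sumTo (suc N) (λ i → + (N C i) * (c ^ i * f (m + + i * t)))
  Δ^-binomial zero f m = trans (unit (f m)) (cong (λ x → + 0 + + 1 * (+ 1 * f x)) (origin m t))
    where
    unit : ∀ x → x ≡ + 0 + + 1 * (+ 1 * x)
    unit = solve-∀
    origin : ∀ m t → m ≡ m + + 0 * t
    origin = solve-∀
  Δ^-binomial (suc N) f m = begin
    Δ^ N f m + c * Δ^ N f (m + t)
      ≡⟨ cong₂ (λ x y → x + c * y) (Δ^-binomial N f m) (Δ^-binomial N f (m + t)) ⟩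
    sumTo (suc N) (λ i → + (N C i) * a i) + c * sumTo (suc N) (λ i → + (N C i) * (c ^ i * f (m + t + + i * t)))
      ≡⟨ cong₂ _+_ (sym (sumTo-pad (suc N) 1 _ (λ i → binomial-vanishes (a i))))
                   (trans (sym (sumTo-*ˡ (suc N) c _)) (sumTo-cong (suc N) step)) ⟩
    sumTo (suc (suc N)) (λ i → + (N C i) * a i) + sumTo (suc N) (λ i → + (N C i) * a (suc i))
      ≡⟨ sumTo-pascal N (suc N) a ⟨
    sumTo (suc (suc N)) (λ i → + (suc N C i) * a i) ∎
    where
    a : ℕ → ℤ
    a i = c ^ i * f (m + + i * t)
    step : ∀ i → c * (+ (N C i) * (c ^ i * f (m + t + + i * t))) ≡ + (N C i) * a (suc i)
    step i = trans (cong (λ x → c * (+ (N C i) * (c ^ i * f x))) (advance m t (+ i)))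
                   (rearrange c (+ (N C i)) (c ^ i) (f (m + + suc i * t)))
      where
      advance : ∀ m t x → m + t + x * t ≡ m + (+ 1 + x) * t
      advance = solve-∀
      rearrange : ∀ c b p y → c * (b * (p * y)) ≡ b * (c * p * y)
      rearrange = solve-∀

  Δ-scaled-shift : ∀ {g} f k v → (∀ b → g b ≡ k * f (b + v)) → ∀ b → Δ g b ≡ k * Δ f (b + v)
  Δ-scaled-shift {g} f k v eq b = begin
    g b + c * g (b + t)                      ≡⟨ cong₂ (λ x y → x + c * y) (eq b) (eq (b + t)) ⟩
    k * f (b + v) + c * (k * f (b + t + v))  ≡⟨ cong (λ x → k * f (b + v) + c * (k * f x)) (right-comm b t v) ⟩
    k * f (b + v) + c * (k * f (b + v + t))  ≡⟨ factor k c (f (b + v)) (f (b + v + t)) ⟩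
    k * (f (b + v) + c * f (b + v + t))      ∎
    where
    right-comm : ∀ x y z → x + y + z ≡ x + z + y
    right-comm = solve-∀
    factor : ∀ k c x y → k * x + c * (k * y) ≡ k * (x + c * y)
    factor = solve-∀

  module _ (X Y : ℤ → ℤ) (p q u : ℤ)
           (ΔX : ∀ b → Δ X b ≡ p * Y (b + u)) (ΔY : ∀ b → Δ Y b ≡ q * X (b + u)) where

    Δ^-alternating-even : ∀ n b → Δ^ (2 ℕ.* n) X b ≡ (p * q) ^ n * X (b + + n * (u + u))
    Δ^-alternating-odd : ∀ n b → Δ^ (suc (2 ℕ.* n)) X b ≡ p * (p * q) ^ n * Y (b + + n * (u + u) + u)

    Δ^-alternating-even zero b = trans (unit (X b)) (cong (λ x → + 1 * X x) (origin b (u + u)))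
      where
      unit : ∀ x → x ≡ + 1 * x
      unit = solve-∀
      origin : ∀ b w → b ≡ b + + 0 * w
      origin = solve-∀
    Δ^-alternating-even (suc n) b = begin
      Δ^ (2 ℕ.* suc n) X b
        ≡⟨ cong (λ N → Δ^ N X b) (ℕₚ.*-suc 2 n) ⟩
      Δ (Δ^ (suc (2 ℕ.* n)) X) b
        ≡⟨ Δ-scaled-shift Y (p * (p * q) ^ n) (+ n * (u + u) + u) odd-reassociated b ⟩
      p * (p * q) ^ n * Δ Y (b + (+ n * (u + u) + u))
        ≡⟨ cong (p * (p * q) ^ n *_) (ΔY _) ⟩
      p * (p * q) ^ n * (q * X (b + (+ n * (u + u) + u) + u))
        ≡⟨ regroup p q ((p * q) ^ n) _ ⟩
      p * q * (p * q) ^ n * X (b + (+ n * (u + u) + u) + u)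
        ≡⟨ cong (λ x → (p * q) ^ suc n * X x) (advance b (+ n) u) ⟩
      (p * q) ^ suc n * X (b + + suc n * (u + u)) ∎
      where
      odd-reassociated : ∀ b → Δ^ (suc (2 ℕ.* n)) X b ≡ p * (p * q) ^ n * Y (b + (+ n * (u + u) + u))
      odd-reassociated b =
        trans (Δ^-alternating-odd n b) (cong (λ x → p * (p * q) ^ n * Y x) (ℤₚ.+-assoc b _ u))
      regroup : ∀ p q r x → p * r * (q * x) ≡ p * q * r * x
      regroup = solve-∀
      advance : ∀ b x u → b + (x * (u + u) + u) + u ≡ b + (+ 1 + x) * (u + u)
      advance = solve-∀
    Δ^-alternating-odd n b = begin
      Δ (Δ^ (2 ℕ.* n) X) b
        ≡⟨ Δ-scaled-shift X ((p * q) ^ n) (+ n * (u + u)) (Δ^-alternating-even n) b ⟩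
      (p * q) ^ n * Δ X (b + + n * (u + u))
        ≡⟨ cong ((p * q) ^ n *_) (ΔX _) ⟩
      (p * q) ^ n * (p * Y (b + + n * (u + u) + u))
        ≡⟨ regroup ((p * q) ^ n) p _ ⟩
      p * (p * q) ^ n * Y (b + + n * (u + u) + u) ∎
      where
      regroup : ∀ r p y → r * (p * y) ≡ p * r * y
      regroup = solve-∀

FibonacciLike : (ℤ → ℤ) → Set
FibonacciLike f = ∀ m → f (m + + 2) ≡ f (m + + 1) + f m

F-fibonacciLike : FibonacciLike F
F-fibonacciLike (+ k) rewrite ℕₚ.+-comm k 2 | ℕₚ.+-comm k 1 = refl
F-fibonacciLike -[1+ 0 ] = refl
F-fibonacciLike -[1+ 1 ] = refl
F-fibonacciLike -[1+ suc (suc k) ] = signed-step ((- + 1) ^ k) (fibℕ (suc k)) (fibℕ (suc (suc k)))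
  where
  signed-step : ∀ p a b → p * a ≡ (- + 1 * p) * b + (- + 1 * (- + 1 * p)) * (b + a)
  signed-step = solve-∀

L-fibonacciLike : FibonacciLike L
L-fibonacciLike (+ k) rewrite ℕₚ.+-comm k 2 | ℕₚ.+-comm k 1 = refl
L-fibonacciLike -[1+ 0 ] = refl
L-fibonacciLike -[1+ 1 ] = refl
L-fibonacciLike -[1+ suc (suc k) ] = signed-step ((- + 1) ^ suc k) (lucℕ (suc k)) (lucℕ (suc (suc k)))
  where
  signed-step : ∀ p a b → p * a ≡ (- + 1 * p) * b + (- + 1 * (- + 1 * p)) * (b + a)
  signed-step = solve-∀

fibonacciLike-+ : ∀ f g → FibonacciLike f → FibonacciLike g → FibonacciLike (λ m → f m + g m)
fibonacciLike-+ f g rf rg m rewrite rf m | rg m = interchange (f (m + + 1)) (f m) (g (m + + 1)) (g m)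
  where
  interchange : ∀ a b c d → a + b + (c + d) ≡ a + c + (b + d)
  interchange = solve-∀

fibonacciLike-* : ∀ k f → FibonacciLike f → FibonacciLike (λ m → k * f m)
fibonacciLike-* k f rf m rewrite rf m = ℤₚ.*-distribˡ-+ k (f (m + + 1)) (f m)

fibonacciLike-shift : ∀ c f → FibonacciLike f → FibonacciLike (λ m → f (m + c))
fibonacciLike-shift c f rf m = begin
  f (m + + 2 + c)             ≡⟨ cong f (right-comm m (+ 2) c) ⟩
  f (m + c + + 2)             ≡⟨ rf (m + c) ⟩
  f (m + c + + 1) + f (m + c) ≡⟨ cong (λ x → f x + f (m + c)) (right-comm m (+ 1) c) ⟨
  f (m + + 1 + c) + f (m + c) ∎
  where
  right-comm : ∀ x y z → x + y + z ≡ x + z + y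
  right-comm = solve-∀

module _ {f g : ℤ → ℤ} (rf : FibonacciLike f) (rg : FibonacciLike g) where

  private
    AgreeAt : ℤ → Set
    AgreeAt m = f m ≡ g m × f (m + + 1) ≡ g (m + + 1)

    agree-up : ∀ m → AgreeAt m → AgreeAt (m + + 1)
    agree-up m (e₀ , e₁) = e₁ , (begin
      f (m + + 1 + + 1)   ≡⟨ cong f (ℤₚ.+-assoc m (+ 1) (+ 1)) ⟩
      f (m + + 2)         ≡⟨ rf m ⟩
      f (m + + 1) + f m   ≡⟨ cong₂ _+_ e₁ e₀ ⟩
      g (m + + 1) + g m   ≡⟨ rg m ⟨
      g (m + + 2)         ≡⟨ cong g (ℤₚ.+-assoc m (+ 1) (+ 1)) ⟨
      g (m + + 1 + + 1)   ∎)

    agree-down : ∀ m → AgreeAt (m + + 1) → AgreeAt m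
    agree-down m (e₁ , e₂) = (begin
      f m                           ≡⟨ back rf ⟩
      f (m + + 2) - f (m + + 1)     ≡⟨ cong₂ _-_ (trans (cong f two) (trans e₂ (cong g (sym two)))) e₁ ⟩
      g (m + + 2) - g (m + + 1)     ≡⟨ back rg ⟨
      g m                           ∎) , e₁
      where
      two : m + + 2 ≡ m + + 1 + + 1
      two = sym (ℤₚ.+-assoc m (+ 1) (+ 1))
      back : ∀ {h} → FibonacciLike h → h m ≡ h (m + + 2) - h (m + + 1)
      back {h} rh = begin
        h m                              ≡⟨ cancel (h (m + + 1)) (h m) ⟩
        h (m + + 1) + h m - h (m + + 1)  ≡⟨ cong (_- h (m + + 1)) (rh m) ⟨
        h (m + + 2) - h (m + + 1)        ∎
        where
        cancel : ∀ a b → b ≡ a + b - a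
        cancel = solve-∀

    agree-nonneg : AgreeAt (+ 0) → ∀ k → AgreeAt (+ k)
    agree-nonneg a₀ zero = a₀
    agree-nonneg a₀ (suc k) =
      subst AgreeAt (cong +_ (ℕₚ.+-comm k 1)) (agree-up (+ k) (agree-nonneg a₀ k))

    agree-nonpos : AgreeAt (+ 0) → ∀ k → AgreeAt (- + k)
    agree-nonpos a₀ zero = a₀
    agree-nonpos a₀ (suc k) =
      agree-down (- + suc k) (subst AgreeAt (sym (predecessor (+ k))) (agree-nonpos a₀ k))
      where
      predecessor : ∀ x → - (+ 1 + x) + + 1 ≡ - x
      predecessor = solve-∀

  fibonacciLike-unique : f (+ 0) ≡ g (+ 0) → f (+ 1) ≡ g (+ 1) → ∀ m → f m ≡ g m
  fibonacciLike-unique e₀ e₁ (+ k) = proj₁ (agree-nonneg (e₀ , e₁) k)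
  fibonacciLike-unique e₀ e₁ -[1+ k ] = proj₁ (agree-nonpos (e₀ , e₁) (suc k))

companion : (ℤ → ℤ) → ℤ → ℤ
companion f m = f (m - + 1) + f (m + + 1)

fibonacciLike-companion : ∀ f → FibonacciLike f → FibonacciLike (companion f)
fibonacciLike-companion f rf =
  fibonacciLike-+ (λ m → f (m - + 1)) (λ m → f (m + + 1))
    (fibonacciLike-shift (- + 1) f rf) (fibonacciLike-shift (+ 1) f rf)

module _ (f : ℤ → ℤ) (rf : FibonacciLike f) where

  fibonacciLike-pred : ∀ m → f (m + + 1) ≡ f m + f (m - + 1)
  fibonacciLike-pred m = begin
    f (m + + 1)                     ≡⟨ cong f (up m) ⟩
    f (m - + 1 + + 2)               ≡⟨ rf (m - + 1) ⟩
    f (m - + 1 + + 1) + f (m - + 1) ≡⟨ cong (λ x → f x + f (m - + 1)) (back m) ⟩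
    f m + f (m - + 1)               ∎
    where
    up : ∀ x → x + + 1 ≡ x - + 1 + + 2
    up = solve-∀
    back : ∀ x → x - + 1 + + 1 ≡ x
    back = solve-∀

  fibonacciLike-addition : ∀ m n → + 2 * f (m + n) ≡ L n * f m + F n * companion f m
  fibonacciLike-addition m n = begin
    + 2 * f (m + n)                 ≡⟨ cong (λ x → + 2 * f x) (ℤₚ.+-comm m n) ⟩
    + 2 * f (n + m)                 ≡⟨ in-n n ⟩
    f m * L n + companion f m * F n ≡⟨ cong₂ _+_ (ℤₚ.*-comm (f m) (L n)) (ℤₚ.*-comm (companion f m) (F n)) ⟩
    L n * f m + F n * companion f m ∎
    where
    at-zero : ∀ a b → + 2 * a ≡ a * + 2 + b * + 0
    at-zero = solve-∀
    at-one : ∀ a b → a + b ≡ a * + 1 + b * + 1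
    at-one = solve-∀
    two-times : ∀ a → + 2 * a ≡ a + a
    two-times = solve-∀
    doubled : + 2 * f (+ 1 + m) ≡ f m + companion f m
    doubled = begin
      + 2 * f (+ 1 + m)               ≡⟨ cong (λ x → + 2 * f x) (ℤₚ.+-comm (+ 1) m) ⟩
      + 2 * f (m + + 1)               ≡⟨ two-times (f (m + + 1)) ⟩
      f (m + + 1) + f (m + + 1)       ≡⟨ cong (_+ f (m + + 1)) (fibonacciLike-pred m) ⟩
      f m + f (m - + 1) + f (m + + 1) ≡⟨ ℤₚ.+-assoc (f m) _ _ ⟩
      f m + companion f m             ∎
    in-n : ∀ n → + 2 * f (n + m) ≡ f m * L n + companion f m * F n
    in-n = fibonacciLike-unique
      (fibonacciLike-* (+ 2) (λ n → f (n + m)) (fibonacciLike-shift m f rf))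
      (fibonacciLike-+ (λ n → f m * L n) (λ n → companion f m * F n)
        (fibonacciLike-* (f m) L L-fibonacciLike) (fibonacciLike-* (companion f m) F F-fibonacciLike))
      (trans (cong (λ x → + 2 * f x) (ℤₚ.+-identityˡ m)) (at-zero (f m) (companion f m)))
      (trans doubled (at-one (f m) (companion f m)))

  companion-companion : ∀ m → companion (companion f) m ≡ + 5 * f m
  companion-companion m = begin
    f (m - + 1 - + 1) + f (m - + 1 + + 1) + (f (m + + 1 - + 1) + f (m + + 1 + + 1))
      ≡⟨ cong₂ (λ x y → f (m - + 1 - + 1) + f x + (f y + f (m + + 1 + + 1))) (back m) (forth m) ⟩
    f (m - + 1 - + 1) + f m + (f m + f (m + + 1 + + 1))
      ≡⟨ cong (λ x → f (m - + 1 - + 1) + f m + (f m + x)) (cong f (ℤₚ.+-assoc m (+ 1) (+ 1)) ) ⟩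
    f (m - + 1 - + 1) + f m + (f m + f (m + + 2))
      ≡⟨ cong (λ x → f (m - + 1 - + 1) + f m + (f m + x)) (rf m) ⟩
    f (m - + 1 - + 1) + f m + (f m + (f (m + + 1) + f m))
      ≡⟨ cong (λ x → f (m - + 1 - + 1) + f m + (f m + (x + f m))) (fibonacciLike-pred m) ⟩
    f (m - + 1 - + 1) + f m + (f m + (f m + f (m - + 1) + f m))
      ≡⟨ regroup (f (m - + 1 - + 1)) (f (m - + 1)) (f m) ⟩
    f (m - + 1) + f (m - + 1 - + 1) + + 4 * f m
      ≡⟨ cong (_+ + 4 * f m) (sym (two-before m)) ⟩
    f m + + 4 * f m
      ≡⟨ five (f m) ⟩
    + 5 * f m ∎
    where
    back : ∀ x → x - + 1 + + 1 ≡ x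
    back = solve-∀
    forth : ∀ x → x + + 1 - + 1 ≡ x
    forth = solve-∀
    regroup : ∀ a b c → a + c + (c + (c + b + c)) ≡ b + a + + 4 * c
    regroup = solve-∀
    five : ∀ c → c + + 4 * c ≡ + 5 * c
    five = solve-∀
    two-before : ∀ x → f x ≡ f (x - + 1) + f (x - + 1 - + 1)
    two-before x = begin
      f x                       ≡⟨ cong f (sym (back x)) ⟩
      f (x - + 1 + + 1)         ≡⟨ fibonacciLike-pred (x - + 1) ⟩
      f (x - + 1) + f (x - + 1 - + 1) ∎

companion-F : ∀ m → companion F m ≡ L m
companion-F = fibonacciLike-unique (fibonacciLike-companion F F-fibonacciLike) L-fibonacciLike refl refl

companion-L : ∀ m → companion L m ≡ + 5 * F m
companion-L = fibonacciLike-unique (fibonacciLike-companion L L-fibonacciLike)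
  (fibonacciLike-* (+ 5) F F-fibonacciLike) refl refl

negOnePow-square : ∀ j → negOnePow j * negOnePow j ≡ + 1
negOnePow-square j = square ∣ j ∣
  where
  square : ∀ k → (- + 1) ^ k * (- + 1) ^ k ≡ + 1
  square zero = refl
  square (suc k) = trans (flip-twice ((- + 1) ^ k)) (square k)
    where
    flip-twice : ∀ p → (- + 1 * p) * (- + 1 * p) ≡ p * p
    flip-twice = solve-∀

F-neg : ∀ n → F (- n) ≡ - (negOnePow n * F n)
F-neg (+ zero) = refl
F-neg (+ suc k) = flip ((- + 1) ^ k) (fibℕ (suc k))
  where
  flip : ∀ p a → p * a ≡ - ((- + 1 * p) * a)
  flip = solve-∀
F-neg -[1+ k ] = begin
  fibℕ (suc k)                                  ≡⟨ ℤₚ.*-identityˡ (fibℕ (suc k)) ⟨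
  + 1 * fibℕ (suc k)                            ≡⟨ cong (_* fibℕ (suc k)) (negOnePow-square -[1+ k ]) ⟨
  (- + 1 * (- + 1) ^ k) * (- + 1 * (- + 1) ^ k) * fibℕ (suc k) ≡⟨ flip ((- + 1) ^ k) (fibℕ (suc k)) ⟩
  - ((- + 1 * (- + 1) ^ k) * ((- + 1) ^ k * fibℕ (suc k))) ∎
  where
  flip : ∀ p a → (- + 1 * p) * (- + 1 * p) * a ≡ - ((- + 1 * p) * (p * a))
  flip = solve-∀

L-neg : ∀ n → L (- n) ≡ negOnePow n * L n
L-neg (+ zero) = refl
L-neg (+ suc k) = refl
L-neg -[1+ k ] = begin
  lucℕ (suc k)                                   ≡⟨ ℤₚ.*-identityˡ (lucℕ (suc k)) ⟨
  + 1 * lucℕ (suc k)                             ≡⟨ cong (_* lucℕ (suc k)) (negOnePow-square -[1+ k ]) ⟨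
  (- + 1) ^ suc k * (- + 1) ^ suc k * lucℕ (suc k) ≡⟨ ℤₚ.*-assoc ((- + 1) ^ suc k) _ _ ⟩
  (- + 1) ^ suc k * ((- + 1) ^ suc k * lucℕ (suc k)) ∎

module _ (f : ℤ → ℤ) (rf : FibonacciLike f) (j : ℤ) where

  private
    e : ℤ
    e = negOnePow j

  fibonacciLike-Δ : ∀ c b →
    + 2 * Shift.Δ c (j + j) f b
      ≡ (negOnePow j + c) * (L j * f (b + j)) + (c - negOnePow j) * (F j * companion f (b + j))
  fibonacciLike-Δ c b = begin
    + 2 * (f b + c * f (b + (j + j)))
      ≡⟨ cong₂ (λ x y → + 2 * (f x + c * f y)) (below b j) (above b j) ⟩
    + 2 * (f (a + - j) + c * f (a + j))
      ≡⟨ distribute (f (a + - j)) c (f (a + j)) ⟩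
    + 2 * f (a + - j) + c * (+ 2 * f (a + j))
      ≡⟨ cong₂ (λ x y → x + c * y) (fibonacciLike-addition f rf a (- j)) (fibonacciLike-addition f rf a j) ⟩
    L (- j) * f a + F (- j) * f̃ + c * (L j * f a + F j * f̃)
      ≡⟨ cong₂ (λ x y → x * f a + y * f̃ + c * (L j * f a + F j * f̃)) (L-neg j) (F-neg j) ⟩
    e * L j * f a + - (e * F j) * f̃ + c * (L j * f a + F j * f̃)
      ≡⟨ collect e c (L j) (F j) (f a) f̃ ⟩
    (e + c) * (L j * f a) + (c - e) * (F j * f̃) ∎
    where
    a f̃ : ℤ
    a = b + j
    f̃ = companion f a
    below : ∀ x y → x ≡ x + y + - y
    below = solve-∀
    above : ∀ x y → x + (y + y) ≡ x + y + y
    above = solve-∀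
    distribute : ∀ x c y → + 2 * (x + c * y) ≡ + 2 * x + c * (+ 2 * y)
    distribute = solve-∀
    collect : ∀ e c l φ x y →
      e * l * x + - (e * φ) * y + c * (l * x + φ * y) ≡ (e + c) * (l * x) + (c - e) * (φ * y)
    collect = solve-∀

  fibonacciLike-Δ⁺ : ∀ b → Shift.Δ (negOnePow j) (j + j) f b ≡ negOnePow j * L j * f (b + j)
  fibonacciLike-Δ⁺ b = ℤₚ.*-cancelˡ-≡ (+ 2) _ _ (begin
    + 2 * Shift.Δ e (j + j) f b                                         ≡⟨ fibonacciLike-Δ e b ⟩
    (e + e) * (L j * f (b + j)) + (e - e) * (F j * companion f (b + j)) ≡⟨ same-sign e (L j) (f (b + j)) _ ⟩
    + 2 * (e * L j * f (b + j))                                         ∎)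
    where
    same-sign : ∀ e l x y → (e + e) * (l * x) + (e - e) * y ≡ + 2 * (e * l * x)
    same-sign = solve-∀

  fibonacciLike-Δ⁻ : ∀ b → Shift.Δ (- negOnePow j) (j + j) f b ≡ - negOnePow j * F j * companion f (b + j)
  fibonacciLike-Δ⁻ b = ℤₚ.*-cancelˡ-≡ (+ 2) _ _ (begin
    + 2 * Shift.Δ (- e) (j + j) f b                                         ≡⟨ fibonacciLike-Δ (- e) b ⟩
    (e + - e) * (L j * f (b + j)) + (- e - e) * (F j * companion f (b + j)) ≡⟨ opposite-sign e (F j) (companion f (b + j)) _ ⟩
    + 2 * (- e * F j * companion f (b + j))                                 ∎)
    where
    opposite-sign : ∀ e φ y x → (e + - e) * x + (- e - e) * (φ * y) ≡ + 2 * (- e * φ * y)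
    opposite-sign = solve-∀

module _ (j s : ℤ) where

  private
    e : ℤ
    e = negOnePow j

  module Δ⁺ = Shift (negOnePow j) (j + j)
  module Δ⁻ = Shift (- negOnePow j) (j + j)

  Δ^-bisection : ∀ X N K d → 2 ℕ.* K ≡ d ℕ.+ suc N →
    + 2 * sumTo K (λ k → + (N C (2 ℕ.* k)) * X (j * (+ 4 * + k + s)))
      ≡ Δ⁺.Δ^ N X (j * s) + Δ⁻.Δ^ N X (j * s)
  Δ^-bisection X N K d 2K≡ = begin
    + 2 * sumTo K (λ k → + (N C (2 ℕ.* k)) * X (j * (+ 4 * + k + s)))
      ≡⟨ cong (+ 2 *_) (sumTo-cong K (λ k → cong (λ y → + (N C (2 ℕ.* k)) * X y) (even-index k))) ⟨
    + 2 * sumTo K (λ k → g (2 ℕ.* k))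
      ≡⟨ sumTo-even-part e (negOnePow-square j) K g ⟨
    sumTo (2 ℕ.* K) h
      ≡⟨ cong (λ M → sumTo M h) 2K≡ ⟩
    sumTo (d ℕ.+ suc N) h
      ≡⟨ sumTo-pad (suc N) d h vanish ⟩
    sumTo (suc N) h
      ≡⟨ sumTo-cong (suc N) (λ i → distribute (+ (N C i)) (e ^ i) ((- e) ^ i) (x i)) ⟩
    sumTo (suc N) (λ i → + (N C i) * (e ^ i * x i) + + (N C i) * ((- e) ^ i * x i))
      ≡⟨ sumTo-+ (suc N) _ _ ⟩
    sumTo (suc N) (λ i → + (N C i) * (e ^ i * x i)) + sumTo (suc N) (λ i → + (N C i) * ((- e) ^ i * x i))
      ≡⟨ cong₂ _+_ (Δ⁺.Δ^-binomial N X (j * s)) (Δ⁻.Δ^-binomial N X (j * s)) ⟨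
    Δ⁺.Δ^ N X (j * s) + Δ⁻.Δ^ N X (j * s) ∎
    where
    x : ℕ → ℤ
    x i = X (j * s + + i * (j + j))
    g : ℕ → ℤ
    g i = + (N C i) * x i
    h : ℕ → ℤ
    h i = e ^ i * g i + (- e) ^ i * g i
    even-index : ∀ k → j * s + + (2 ℕ.* k) * (j + j) ≡ j * (+ 4 * + k + s)
    even-index k = trans (cong (λ y → j * s + y * (j + j)) (ℤₚ.pos-* 2 k)) (expand j s (+ k))
      where
      expand : ∀ j s y → j * s + + 2 * y * (j + j) ≡ j * (+ 4 * y + s)
      expand = solve-∀
    distribute : ∀ b p q y → p * (b * y) + q * (b * y) ≡ b * (p * y) + b * (q * y)
    distribute = solve-∀
    vanish : ∀ i → suc N ℕ.≤ i → h i ≡ + 0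
    vanish i N<i rewrite binomial-vanishes (x i) N<i = absorb (e ^ i) ((- e) ^ i)
      where
      absorb : ∀ p q → p * + 0 + q * + 0 ≡ + 0
      absorb = solve-∀

  module _ (X : ℤ → ℤ) (rX : FibonacciLike X) where

    private
      p q : ℤ
      p = - e * F j
      q = - e * F j * + 5

      signs-cancel : ∀ y → e * e * y ≡ y
      signs-cancel y = trans (cong (_* y) (negOnePow-square j)) (ℤₚ.*-identityˡ y)

      Δ⁺X : ∀ b → Δ⁺.Δ X b ≡ e * L j * X (b + j)
      Δ⁺X = fibonacciLike-Δ⁺ X rX j

      Δ⁻X : ∀ b → Δ⁻.Δ X b ≡ p * companion X (b + j)
      Δ⁻X = fibonacciLike-Δ⁻ X rX j

      Δ⁻X̃ : ∀ b → Δ⁻.Δ (companion X) b ≡ q * X (b + j)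
      Δ⁻X̃ b = begin
        Δ⁻.Δ (companion X) b               ≡⟨ fibonacciLike-Δ⁻ (companion X) (fibonacciLike-companion X rX) j b ⟩
        p * companion (companion X) (b + j) ≡⟨ cong (p *_) (companion-companion X rX (b + j)) ⟩
        p * (+ 5 * X (b + j))               ≡⟨ ℤₚ.*-assoc p (+ 5) _ ⟨
        q * X (b + j)                      ∎

      L-power : ∀ n → (e * L j * (e * L j)) ^ n ≡ L j ^ (2 ℕ.* n)
      L-power n = trans (cong (_^ n) (trans (regroup e (L j)) (signs-cancel (L j * L j)))) (^-square (L j) n)
        where
        regroup : ∀ e y → e * y * (e * y) ≡ e * e * (y * y)
        regroup = solve-∀

      F-power : ∀ n → (p * q) ^ n ≡ (+ 5) ^ n * F j ^ (2 ℕ.* n)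
      F-power n = begin
        (p * q) ^ n                  ≡⟨ cong (_^ n) (trans (regroup e (F j)) (signs-cancel (+ 5 * (F j * F j)))) ⟩
        (+ 5 * (F j * F j)) ^ n      ≡⟨ ^-distrib-* (+ 5) (F j * F j) n ⟩
        (+ 5) ^ n * (F j * F j) ^ n  ≡⟨ cong ((+ 5) ^ n *_) (^-square (F j) n) ⟩
        (+ 5) ^ n * F j ^ (2 ℕ.* n)  ∎
        where
        regroup : ∀ e y → - e * y * (- e * y * + 5) ≡ e * e * (+ 5 * (y * y))
        regroup = solve-∀

    fibonacciLike-even-identity : ∀ n →
      + 2 * sumTo (suc n) (λ k → + ((2 ℕ.* n) C (2 ℕ.* k)) * X (j * (+ 4 * + k + s)))
        ≡ (L j ^ (2 ℕ.* n) + (+ 5) ^ n * F j ^ (2 ℕ.* n)) * X (j * (+ 2 * + n + s))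
    fibonacciLike-even-identity n = begin
      + 2 * sumTo (suc n) (λ k → + ((2 ℕ.* n) C (2 ℕ.* k)) * X (j * (+ 4 * + k + s)))
        ≡⟨ Δ^-bisection X (2 ℕ.* n) (suc n) 1 (ℕₚ.*-suc 2 n) ⟩
      Δ⁺.Δ^ (2 ℕ.* n) X (j * s) + Δ⁻.Δ^ (2 ℕ.* n) X (j * s)
        ≡⟨ cong₂ _+_ (Δ⁺.Δ^-alternating-even X X (e * L j) (e * L j) j Δ⁺X Δ⁺X n (j * s))
                     (Δ⁻.Δ^-alternating-even X (companion X) p q j Δ⁻X Δ⁻X̃ n (j * s)) ⟩
      (e * L j * (e * L j)) ^ n * X a + (p * q) ^ n * X a
        ≡⟨ cong₂ (λ u v → u * X a + v * X a) (L-power n) (F-power n) ⟩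
      L j ^ (2 ℕ.* n) * X a + (+ 5) ^ n * F j ^ (2 ℕ.* n) * X a
        ≡⟨ ℤₚ.*-distribʳ-+ (X a) (L j ^ (2 ℕ.* n)) _ ⟨
      (L j ^ (2 ℕ.* n) + (+ 5) ^ n * F j ^ (2 ℕ.* n)) * X a
        ≡⟨ cong (λ y → (L j ^ (2 ℕ.* n) + (+ 5) ^ n * F j ^ (2 ℕ.* n)) * X y) (index j s (+ n)) ⟩
      (L j ^ (2 ℕ.* n) + (+ 5) ^ n * F j ^ (2 ℕ.* n)) * X (j * (+ 2 * + n + s)) ∎
      where
      a : ℤ
      a = j * s + + n * (j + j)
      index : ∀ j s y → j * s + y * (j + j) ≡ j * (+ 2 * y + s)
      index = solve-∀

    fibonacciLike-odd-identity : ∀ n → ℕ.NonZero n →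
      + 2 * sumTo n (λ k → + ((2 ℕ.* n ℕ.∸ 1) C (2 ℕ.* k)) * X (j * (+ 4 * + k + s)))
        ≡ negOnePow j * (L j ^ (2 ℕ.* n ℕ.∸ 1) * X (j * (+ 2 * + n + s - + 1))
            - (+ 5) ^ (n ℕ.∸ 1) * F j ^ (2 ℕ.* n ℕ.∸ 1) * companion X (j * (+ 2 * + n + s - + 1)))
    fibonacciLike-odd-identity (suc m) _ =
      subst (λ N → + 2 * sumTo (suc m) (λ k → + (N C (2 ℕ.* k)) * X (j * (+ 4 * + k + s)))
                     ≡ e * (L j ^ N * X b - (+ 5) ^ m * F j ^ N * companion X b))
            (sym (odd-predecessor m)) (begin
      + 2 * sumTo (suc m) (λ k → + (suc (2 ℕ.* m) C (2 ℕ.* k)) * X (j * (+ 4 * + k + s)))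
        ≡⟨ Δ^-bisection X (suc (2 ℕ.* m)) (suc m) 0 (ℕₚ.*-suc 2 m) ⟩
      Δ⁺.Δ^ (suc (2 ℕ.* m)) X (j * s) + Δ⁻.Δ^ (suc (2 ℕ.* m)) X (j * s)
        ≡⟨ cong₂ _+_ (Δ⁺.Δ^-alternating-odd X X (e * L j) (e * L j) j Δ⁺X Δ⁺X m (j * s))
                     (Δ⁻.Δ^-alternating-odd X (companion X) p q j Δ⁻X Δ⁻X̃ m (j * s)) ⟩
      e * L j * (e * L j * (e * L j)) ^ m * X a + p * (p * q) ^ m * companion X a
        ≡⟨ cong₂ (λ u v → e * L j * u * X a + p * v * companion X a) (L-power m) (F-power m) ⟩
      e * L j * L j ^ (2 ℕ.* m) * X a + p * ((+ 5) ^ m * F j ^ (2 ℕ.* m)) * companion X a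
        ≡⟨ collect e (L j) (L j ^ (2 ℕ.* m)) (X a) (F j) ((+ 5) ^ m) (F j ^ (2 ℕ.* m)) (companion X a) ⟩
      e * (L j ^ suc (2 ℕ.* m) * X a - (+ 5) ^ m * F j ^ suc (2 ℕ.* m) * companion X a)
        ≡⟨ cong (λ y → e * (L j ^ suc (2 ℕ.* m) * X y - (+ 5) ^ m * F j ^ suc (2 ℕ.* m) * companion X y)) (index j s (+ m)) ⟩
      e * (L j ^ suc (2 ℕ.* m) * X b - (+ 5) ^ m * F j ^ suc (2 ℕ.* m) * companion X b) ∎)
      where
      a b : ℤ
      a = j * s + + m * (j + j) + j
      b = j * (+ 2 * + suc m + s - + 1)
      collect : ∀ e l l′ x φ r φ′ y →
        e * l * l′ * x + - e * φ * (r * φ′) * y ≡ e * (l * l′ * x - r * (φ * φ′) * y)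
      collect = solve-∀
      index : ∀ j s y → j * s + y * (j + j) + j ≡ j * (+ 2 * (+ 1 + y) + s - + 1)
      index = solve-∀

  F-odd-identity : ∀ n → ℕ.NonZero n →
    + 2 * sumTo n (λ k → + ((2 ℕ.* n ℕ.∸ 1) C (2 ℕ.* k)) * F (j * (+ 4 * + k + s)))
      ≡ negOnePow j * (L j ^ (2 ℕ.* n ℕ.∸ 1) * F (j * (+ 2 * + n + s - + 1))
          - (+ 5) ^ (n ℕ.∸ 1) * F j ^ (2 ℕ.* n ℕ.∸ 1) * L (j * (+ 2 * + n + s - + 1)))
  F-odd-identity n nz =
    trans (fibonacciLike-odd-identity F F-fibonacciLike n nz)
          (cong (λ y → e * (L j ^ N * F a - (+ 5) ^ (n ℕ.∸ 1) * F j ^ N * y)) (companion-F a))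
    where
    N : ℕ
    N = 2 ℕ.* n ℕ.∸ 1
    a : ℤ
    a = j * (+ 2 * + n + s - + 1)

  L-odd-identity : ∀ n → ℕ.NonZero n →
    + 2 * sumTo n (λ k → + ((2 ℕ.* n ℕ.∸ 1) C (2 ℕ.* k)) * L (j * (+ 4 * + k + s)))
      ≡ negOnePow j * (L j ^ (2 ℕ.* n ℕ.∸ 1) * L (j * (+ 2 * + n + s - + 1))
          - (+ 5) ^ n * F j ^ (2 ℕ.* n ℕ.∸ 1) * F (j * (+ 2 * + n + s - + 1)))
  L-odd-identity (suc m) nz =
    trans (fibonacciLike-odd-identity L L-fibonacciLike (suc m) nz)
          (cong (λ y → e * (L j ^ (2 ℕ.* suc m ℕ.∸ 1) * L a - y)) (trans (cong (r * φ *_) (companion-L a)) (regroup r φ (F a))))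
    where
    a r φ : ℤ
    a = j * (+ 2 * + suc m + s - + 1)
    r = (+ 5) ^ m
    φ = F j ^ (2 ℕ.* suc m ℕ.∸ 1)
    regroup : ∀ r φ y → r * φ * (+ 5 * y) ≡ + 5 * r * φ * y
    regroup = solve-∀

theorem1 : (s j : ℤ) →
    ((n : ℕ) →
      ((+ 2) * sumTo (suc n) (λ k → (+ ((2 ℕ.* n) C (2 ℕ.* k))) * F (j * ((+ 4) * (+ k) + s)))
        ≡ ((L j ^ (2 ℕ.* n)) + ((+ 5) ^ n) * (F j ^ (2 ℕ.* n))) * F (j * ((+ 2) * (+ n) + s)))
      × ((+ 2) * sumTo (suc n) (λ k → (+ ((2 ℕ.* n) C (2 ℕ.* k))) * L (j * ((+ 4) * (+ k) + s)))
        ≡ ((L j ^ (2 ℕ.* n)) + ((+ 5) ^ n) * (F j ^ (2 ℕ.* n))) * L (j * ((+ 2) * (+ n) + s))))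
    × ((n : ℕ) → ℕ.NonZero n →
      ((+ 2) * sumTo n (λ k → (+ ((2 ℕ.* n ℕ.∸ 1) C (2 ℕ.* k))) * F (j * ((+ 4) * (+ k) + s)))
        ≡ negOnePow j * ((L j ^ (2 ℕ.* n ℕ.∸ 1)) * F (j * ((+ 2) * (+ n) + s - + 1))
            - ((+ 5) ^ (n ℕ.∸ 1)) * (F j ^ (2 ℕ.* n ℕ.∸ 1)) * L (j * ((+ 2) * (+ n) + s - + 1))))
      × ((+ 2) * sumTo n (λ k → (+ ((2 ℕ.* n ℕ.∸ 1) C (2 ℕ.* k))) * L (j * ((+ 4) * (+ k) + s)))
        ≡ negOnePow j * ((L j ^ (2 ℕ.* n ℕ.∸ 1)) * L (j * ((+ 2) * (+ n) + s - + 1))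
            - ((+ 5) ^ n) * (F j ^ (2 ℕ.* n ℕ.∸ 1)) * F (j * ((+ 2) * (+ n) + s - + 1)))))
theorem1 s j =
  (λ n → fibonacciLike-even-identity j s F F-fibonacciLike n , fibonacciLike-even-identity j s L L-fibonacciLike n) ,
  (λ n nz → F-odd-identity j s n nz , L-odd-identity j s n nz)
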